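{- Let $V = V_1 \cup \cdots \cup V_m$ be a finite set partitioned into $m$ colors, let integers $k$ and $\ell_i \le u_i$ ($i \in [m]$) be given, and let $D_1, \ldots, D_n$ be pairwise disjoint subsets of $V$. Assume there is a set $O \subseteq V$ satisfying the fairness constraints such that $|D_i \cap O| \leq 1$ for every $i$ and $O \subseteq \bigcup_i D_i$. Then $\mathrm{FLOW}(\{D_i\}, \{\ell_i\}, \{u_i\}, k)$ outputs a set $S$ satisfying the fairness constraints.
   Context: A set $S \subseteq V$ satisfies the fairness constraints if $|S| = k$ and $\ell_i \leq |S \cap V_i| \leq u_i$ for every $i \in [m]$. The procedure $\mathrm{FLOW}(\{D_i\},\{\ell_i\},\{u_i\},k)$: build a flow network $H$ with vertices $s$, $z$, $t$, one vertex for each cluster $D_1,\ldots,D_n$ and one vertex $c_j$ for each color $j \in [m]$; edges: $s \to D_i$ with capacity $1$ for every $i$; $D_i \to c_j$ with capacity $1$ whenever $D_i$ contains a point of color $j$; $c_j \to t$ with capacity $\ell_j$ and $c_j \to z$ with capacity $u_j - \ell_j$ for every $j$; $z \to t$ with capacity $k - \sum_i \ell_i$. Compute an integral maximum $s$–$t$ flow in $H$. Set $S = \emptyset$; for each $i$, if $D_i$ sends flow to $c_j$, add to $S$ any point of $D_i$ of color $j$. Output $S$. -}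

module Defs where

open import Data.Nat using (ℕ; zero; suc; _+_; _∸_; _≤_; _<_; _<?_)
open import Data.Fin using (Fin; _≟_)
open import Data.Fin.Subset using (Subset; _∈_; _∩_; ∣_∣; _⊆_; ⋃)
open import Data.Fin.Subset.Properties using (_∈?_)
open import Data.Fin.Properties using (any?)
open import Data.Vec using (tabulate)
open import Data.List using (List; map)
open import Data.List using () renaming (allFin to allFinL)
open import Data.Bool using (if_then_else_)
open import Data.Product using (_×_; Σ; ∃)
open import Relation.Nullary using (¬_)
open import Relation.Nullary.Decidable using (⌊_⌋; _×-dec_)
open import Relation.Binary.PropositionalEquality using (_≡_; _≢_)
open import Data.Empty using (⊥)

∑ : ∀ {n} → (Fin n → ℕ) → ℕ
∑ {zero}  f = 0
∑ {suc n} f = f Fin.zero + ∑ (λ i → f (Fin.suc i))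

-- Ground set V = Fin N, colouring col : Fin N → Fin m (V_j = col⁻¹ j).

colourClass : ∀ {N m} → (Fin N → Fin m) → Fin m → Subset N
colourClass col j = tabulate (λ v → ⌊ col v ≟ j ⌋)

Fair : ∀ {N m} → (Fin N → Fin m) → (ℓ u : Fin m → ℕ) → ℕ → Subset N → Set
Fair col ℓ u k S =
  ∣ S ∣ ≡ k ×
  (∀ j → ℓ j ≤ ∣ S ∩ colourClass col j ∣ × ∣ S ∩ colourClass col j ∣ ≤ u j)

PairwiseDisjoint : ∀ {N n} → (Fin n → Subset N) → Set
PairwiseDisjoint D = ∀ i j → i ≢ j → ∀ v → v ∈ D i → v ∈ D j → ⊥

⋃Fam : ∀ {N n} → (Fin n → Subset N) → Subset N
⋃Fam {n = n} D = ⋃ (map D (allFinL n))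

record Network : Set₁ where
  field
    Node  : Set
    sumN  : (Node → ℕ) → ℕ
    src   : Node
    snk   : Node
    cap   : Node → Node → ℕ       -- capacity (0 = no edge)

module _ (H : Network) where
  open Network H

  IsFlow : (Node → Node → ℕ) → Set
  IsFlow f =
    (∀ x y → f x y ≤ cap x y) ×
    (∀ x → x ≢ src → x ≢ snk → sumN (λ y → f y x) ≡ sumN (λ y → f x y))

  value : (Node → Node → ℕ) → ℕ
  value f = sumN (λ y → f src y) ∸ sumN (λ y → f y src)

  IsMaxFlow : (Node → Node → ℕ) → Set
  IsMaxFlow f = IsFlow f × (∀ g → IsFlow g → value g ≤ value f)

data HNode (n m : ℕ) : Set where
  s z t : HNode n m
  dn    : Fin n → HNode n m
  cn    : Fin m → HNode n m

sumH : ∀ {n m} → (HNode n m → ℕ) → ℕ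
sumH f = f s + f z + f t + ∑ (λ i → f (dn i)) + ∑ (λ j → f (cn j))

HasColour : ∀ {N n m} → (Fin N → Fin m) → (Fin n → Subset N) → Fin n → Fin m → Set
HasColour col D i j = ∃ λ v → v ∈ D i × col v ≡ j

capH : ∀ {N n m} → (Fin N → Fin m) → (Fin n → Subset N) →
       (ℓ u : Fin m → ℕ) → ℕ → HNode n m → HNode n m → ℕ
capH col D ℓ u k s      (dn i) = 1
capH col D ℓ u k (dn i) (cn j) =
  if ⌊ any? (λ v → (v ∈? D i) ×-dec (col v ≟ j)) ⌋ then 1 else 0
capH col D ℓ u k (cn j) t      = ℓ j
capH col D ℓ u k (cn j) z      = u j ∸ ℓ j
capH col D ℓ u k z      t      = k ∸ ∑ ℓ
capH col D ℓ u k _      _      = 0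

H : ∀ {N n m} → (Fin N → Fin m) → (Fin n → Subset N) →
    (ℓ u : Fin m → ℕ) → ℕ → Network
H {n = n} {m} col D ℓ u k = record
  { Node = HNode n m ; sumN = sumH ; src = s ; snk = t
  ; cap = capH col D ℓ u k }

ValidPick : ∀ {N n m} → (Fin N → Fin m) → (Fin n → Subset N) →
            (HNode n m → HNode n m → ℕ) → (Fin n → Fin m → Fin N) → Set
ValidPick col D f pick =
  ∀ i j → 0 < f (dn i) (cn j) → pick i j ∈ D i × col (pick i j) ≡ j

outputS : ∀ {N n m} → (HNode n m → HNode n m → ℕ) → (Fin n → Fin m → Fin N) → Subset N
outputS f pick = tabulate λ v →
  ⌊ any? (λ i → any? (λ j → (0 <? f (dn i) (cn j)) ×-dec (pick i j ≟ v))) ⌋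

{-# OPTIONS --safe #-}
module Submission where

-- Routing each point of O through its cluster and its colour gives a flow of value k in H:
-- colour j sends ℓ j units straight to t and the remaining |O ∩ V j| - ℓ j through z. The
-- arcs into t have total capacity (k - ∑ ℓ) + ∑ ℓ = k (fairness of O gives ∑ ℓ ≤ k), so a
-- maximum flow f has value exactly k and saturates every arc c j → t. Each cluster carries at
-- most one unit and the clusters are disjoint, so the picked points are distinct and
-- |S ∩ V j| is the flow through c j; it lies between ℓ j and (u j - ℓ j) + ℓ j = u j, and
-- summing over j gives |S| = value f = k.

open import Defs
open import Algebra.Bundles using (CommutativeMonoid)
import Algebra.Properties.CommutativeSemigroup as CommutativeSemigroupProperties
open import Data.Bool using (true; false; if_then_else_)
open import Data.Bool.Properties using (T-≡)
open import Data.Empty using (⊥-elim)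
open import Data.Fin using (Fin; zero; suc; _≟_)
open import Data.Fin.Properties using (suc-injective; any?)
open import Data.Fin.Subset using (Subset; _∈_; _∉_; _⊆_; _∩_; ∣_∣; ⋃; ⁅_⁆; Empty)
open import Data.Fin.Subset.Properties
  using (_∈?_; x∈p∩q⁺; x∈p∩q⁻; x∈p∪q⁻; ∉⊥; Empty-unique; nonempty?; ∣⊥∣≡0; x∈⁅x⁆; x∈⁅y⁆⇒x≡y;
         ∣⁅x⁆∣≡1; ⊆-antisym; ∣p∩q∣≤∣p∣; ∩-comm; ∩-commutativeMonoid)
open import Data.List using (List; []; _∷_; map; allFin)
open import Data.Nat using (ℕ; zero; suc; _+_; _∸_; _≤_; _<_; _<?_; z≤n; s≤s)
open import Data.Nat.Properties
  using (+-0-commutativeMonoid; +-identityʳ; +-mono-≤; +-mono-<-≤; +-monoˡ-≤; +-cancelˡ-≤;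
         ≤-refl; ≤-trans; ≤-reflexive; ≤-antisym; <-irrefl; <⇒≱; ≰⇒>; _≤?_; n≤0⇒n≡0; m≤n+m;
         ∸-monoˡ-≤; m+n∸n≡m; m∸n+n≡m; module ≤-Reasoning)
open import Data.Product using (Σ; ∃; _×_; _,_; proj₁; proj₂)
open import Data.Sum using ([_,_]′)
open import Data.Vec using ([]; _∷_; tabulate)
open import Data.Vec.Properties using (lookup∘tabulate; []=⇒lookup; lookup⇒[]=)
open import Function using (_∘_; id; Equivalence)
open import Relation.Binary.PropositionalEquality
open import Relation.Nullary using (yes; no; does)
open import Relation.Nullary.Decidable
  using (⌊_⌋; _×-dec_; dec-true; dec-false; toWitness; fromWitness)
open import Relation.Unary using (Pred; Decidable)

open import Algebra.Properties.CommutativeMonoid.Sum +-0-commutativeMonoid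
  using (sum; sum-cong-≗; sum-replicate-zero)
  renaming (∑-distrib-+ to sum-distrib-+; ∑-comm to sum-comm)

∑≡sum : ∀ {n} (f : Fin n → ℕ) → ∑ f ≡ sum f
∑≡sum {zero}  f = refl
∑≡sum {suc n} f = cong (f zero +_) (∑≡sum (f ∘ suc))

∑-cong : ∀ {n} {f g : Fin n → ℕ} → f ≗ g → ∑ f ≡ ∑ g
∑-cong {f = f} {g} f≗g = trans (∑≡sum f) (trans (sum-cong-≗ f≗g) (sym (∑≡sum g)))

∑-zero : ∀ {n} {f : Fin n → ℕ} → (∀ i → f i ≡ 0) → ∑ f ≡ 0
∑-zero {n} f≗0 = trans (∑-cong f≗0) (trans (∑≡sum {n} (λ _ → 0)) (sum-replicate-zero n))

∑-distrib-+ : ∀ {n} (f g : Fin n → ℕ) → ∑ (λ i → f i + g i) ≡ ∑ f + ∑ g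
∑-distrib-+ f g = trans (∑≡sum (λ i → f i + g i))
                        (trans (sum-distrib-+ f g) (sym (cong₂ _+_ (∑≡sum f) (∑≡sum g))))

∑-comm : ∀ {n m} (a : Fin n → Fin m → ℕ) →
         ∑ (λ i → ∑ (λ j → a i j)) ≡ ∑ (λ j → ∑ (λ i → a i j))
∑-comm a = begin
  ∑ (λ i → ∑ (a i))               ≡⟨ ∑-cong (∑≡sum ∘ a) ⟩
  ∑ (λ i → sum (a i))             ≡⟨ ∑≡sum (λ i → sum (a i)) ⟩
  sum (λ i → sum (a i))           ≡⟨ sum-comm a ⟩
  sum (λ j → sum (λ i → a i j))   ≡⟨ ∑≡sum (λ j → sum (λ i → a i j)) ⟨
  ∑ (λ j → sum (λ i → a i j))     ≡⟨ ∑-cong (λ j → ∑≡sum (λ i → a i j)) ⟨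
  ∑ (λ j → ∑ (λ i → a i j))       ∎
  where open ≡-Reasoning

∑-mono : ∀ {n} {f g : Fin n → ℕ} → (∀ i → f i ≤ g i) → ∑ f ≤ ∑ g
∑-mono {zero}  f≤g = z≤n
∑-mono {suc n} f≤g = +-mono-≤ (f≤g zero) (∑-mono (f≤g ∘ suc))

∑-∸ : ∀ {n} {f g : Fin n → ℕ} → (∀ i → g i ≤ f i) → ∑ (λ i → f i ∸ g i) ≡ ∑ f ∸ ∑ g
∑-∸ {f = f} {g} g≤f = begin
  ∑ (λ i → f i ∸ g i)               ≡⟨ m+n∸n≡m _ (∑ g) ⟨
  ∑ (λ i → f i ∸ g i) + ∑ g ∸ ∑ g   ≡⟨ cong (_∸ ∑ g) (∑-distrib-+ (λ i → f i ∸ g i) g) ⟨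
  ∑ (λ i → f i ∸ g i + g i) ∸ ∑ g   ≡⟨ cong (_∸ ∑ g) (∑-cong (λ i → m∸n+n≡m (g≤f i))) ⟩
  ∑ f ∸ ∑ g                         ∎
  where open ≡-Reasoning

∑-single : ∀ {n} {f : Fin n → ℕ} (i₀ : Fin n) → (∀ i → i ≢ i₀ → f i ≡ 0) → ∑ f ≡ f i₀
∑-single {f = f} zero others =
  trans (cong (f zero +_) (∑-zero (λ i → others (suc i) λ ()))) (+-identityʳ (f zero))
∑-single (suc i₀) others =
  cong₂ _+_ (others zero λ ()) (∑-single i₀ (λ i i≢i₀ → others (suc i) (i≢i₀ ∘ suc-injective)))

∑-mono-tight : ∀ {n} {f g : Fin n → ℕ} → (∀ i → f i ≤ g i) → ∑ g ≤ ∑ f → ∀ i → g i ≤ f i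
∑-mono-tight {f = f} {g} f≤g ∑g≤∑f zero with g zero ≤? f zero
... | yes g₀≤f₀ = g₀≤f₀
... | no  g₀≰f₀ = ⊥-elim (<⇒≱ (+-mono-<-≤ (≰⇒> g₀≰f₀) (∑-mono (f≤g ∘ suc))) ∑g≤∑f)
∑-mono-tight {f = f} f≤g ∑g≤∑f (suc i) =
  ∑-mono-tight (f≤g ∘ suc) (+-cancelˡ-≤ (f zero) _ _ (≤-trans (+-monoˡ-≤ _ (f≤g zero)) ∑g≤∑f)) i

χ : ∀ {N} → Subset N → Fin N → ℕ
χ p v = if does (v ∈? p) then 1 else 0

χ-∈ : ∀ {N} {p : Subset N} {v} → v ∈ p → χ p v ≡ 1
χ-∈ {p = p} {v} v∈p rewrite dec-true (v ∈? p) v∈p = refl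

χ-∉ : ∀ {N} {p : Subset N} {v} → v ∉ p → χ p v ≡ 0
χ-∉ {p = p} {v} v∉p rewrite dec-false (v ∈? p) v∉p = refl

∣p∣≡∑χ : ∀ {N} (p : Subset N) → ∣ p ∣ ≡ ∑ (χ p)
∣p∣≡∑χ []          = refl
∣p∣≡∑χ (true ∷ p)  = cong suc (∣p∣≡∑χ p)
∣p∣≡∑χ (false ∷ p) = ∣p∣≡∑χ p

∣p∣≡∑∣p∩qᵢ∣ : ∀ {N n} {p : Subset N} {q : Fin n → Subset N} → PairwiseDisjoint q →
              (∀ {v} → v ∈ p → ∃ λ i → v ∈ q i) → ∣ p ∣ ≡ ∑ (λ i → ∣ p ∩ q i ∣)
∣p∣≡∑∣p∩qᵢ∣ {p = p} {q} disjoint cover = begin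
  ∣ p ∣                              ≡⟨ ∣p∣≡∑χ p ⟩
  ∑ (χ p)                            ≡⟨ ∑-cong ∑ᵢχ[p∩qᵢ]≡χp ⟨
  ∑ (λ v → ∑ (λ i → χ (p ∩ q i) v))  ≡⟨ ∑-comm (λ v i → χ (p ∩ q i) v) ⟩
  ∑ (λ i → ∑ (χ (p ∩ q i)))          ≡⟨ ∑-cong (λ i → ∣p∣≡∑χ (p ∩ q i)) ⟨
  ∑ (λ i → ∣ p ∩ q i ∣)              ∎
  where
  open ≡-Reasoning
  ∑ᵢχ[p∩qᵢ]≡χp : ∀ v → ∑ (λ i → χ (p ∩ q i) v) ≡ χ p v
  ∑ᵢχ[p∩qᵢ]≡χp v with v ∈? p
  ... | no v∉p = ∑-zero (λ i → χ-∉ (v∉p ∘ proj₁ ∘ x∈p∩q⁻ p (q i)))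
  ... | yes v∈p with i₀ , v∈qᵢ₀ ← cover v∈p =
    trans (∑-single i₀ others) (χ-∈ (x∈p∩q⁺ (v∈p , v∈qᵢ₀)))
    where
    others : ∀ i → i ≢ i₀ → χ (p ∩ q i) v ≡ 0
    others i i≢i₀ = χ-∉ (λ v∈p∩qᵢ → disjoint i i₀ i≢i₀ v (proj₂ (x∈p∩q⁻ p (q i) v∈p∩qᵢ)) v∈qᵢ₀)

x∈⋃map⁻ : ∀ {A : Set} {N} (q : A → Subset N) (is : List A) {v} →
          v ∈ ⋃ (map q is) → ∃ λ i → v ∈ q i
x∈⋃map⁻ q []       v∈⋃ = ⊥-elim (∉⊥ v∈⋃)
x∈⋃map⁻ q (i ∷ is) v∈⋃ = [ (i ,_) , x∈⋃map⁻ q is ]′ (x∈p∪q⁻ (q i) (⋃ (map q is)) v∈⋃)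

Empty⇒∣p∣≡0 : ∀ {N} {p : Subset N} → Empty p → ∣ p ∣ ≡ 0
Empty⇒∣p∣≡0 {N} empty = trans (cong ∣_∣ (Empty-unique empty)) (∣⊥∣≡0 N)

∣p∣≡1 : ∀ {N} {p : Subset N} {x} → x ∈ p → (∀ {y} → y ∈ p → y ≡ x) → ∣ p ∣ ≡ 1
∣p∣≡1 {p = p} {x} x∈p unique = trans (cong ∣_∣ p≡⁅x⁆) (∣⁅x⁆∣≡1 x)
  where
  p≡⁅x⁆ : p ≡ ⁅ x ⁆
  p≡⁅x⁆ = ⊆-antisym (λ y∈p → subst (_∈ ⁅ x ⁆) (sym (unique y∈p)) (x∈⁅x⁆ x))
                    (λ y∈⁅x⁆ → subst (_∈ p) (sym (x∈⁅y⁆⇒x≡y x y∈⁅x⁆)) x∈p)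

pairwiseDisjoint⇒≡ : ∀ {N n} {q : Fin n → Subset N} → PairwiseDisjoint q →
                     ∀ {i j v} → v ∈ q i → v ∈ q j → i ≡ j
pairwiseDisjoint⇒≡ disjoint {i} {j} {v} v∈qᵢ v∈qⱼ with i ≟ j
... | yes i≡j = i≡j
... | no  i≢j = ⊥-elim (disjoint i j i≢j v v∈qᵢ v∈qⱼ)

module _ {a N} {P : Pred (Fin N) a} (P? : Decidable P) where

  ∈-tabulate⁺ : ∀ {v} → P v → v ∈ tabulate (λ w → ⌊ P? w ⌋)
  ∈-tabulate⁺ {v} Pv =
    lookup⇒[]= v _ (trans (lookup∘tabulate _ v) (Equivalence.to T-≡ (fromWitness Pv)))

  ∈-tabulate⁻ : ∀ {v} → v ∈ tabulate (λ w → ⌊ P? w ⌋) → P v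
  ∈-tabulate⁻ {v} v∈ =
    toWitness (Equivalence.from T-≡ (trans (sym (lookup∘tabulate _ v)) ([]=⇒lookup v∈)))

module _ {N m} {col : Fin N → Fin m} where

  ∈-colourClass⁺ : ∀ {v j} → col v ≡ j → v ∈ colourClass col j
  ∈-colourClass⁺ {j = j} = ∈-tabulate⁺ (λ v → col v ≟ j)

  ∈-colourClass⁻ : ∀ {v j} → v ∈ colourClass col j → col v ≡ j
  ∈-colourClass⁻ {j = j} = ∈-tabulate⁻ (λ v → col v ≟ j)

colourClass-disjoint : ∀ {N m} (col : Fin N → Fin m) → PairwiseDisjoint (colourClass col)
colourClass-disjoint col i j i≢j v v∈Vᵢ v∈Vⱼ =
  i≢j (trans (sym (∈-colourClass⁻ v∈Vᵢ)) (∈-colourClass⁻ v∈Vⱼ))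

∣p∣≡∑∣p∩colourClass∣ : ∀ {N m} (col : Fin N → Fin m) (p : Subset N) →
                        ∣ p ∣ ≡ ∑ (λ j → ∣ p ∩ colourClass col j ∣)
∣p∣≡∑∣p∩colourClass∣ col p =
  ∣p∣≡∑∣p∩qᵢ∣ {p = p} (colourClass-disjoint col) (λ {v} _ → col v , ∈-colourClass⁺ refl)

Fair⇒∑ℓ≤k : ∀ {N m} {col : Fin N → Fin m} {ℓ u k p} → Fair col ℓ u k p → ∑ ℓ ≤ k
Fair⇒∑ℓ≤k {col = col} {ℓ} {p = p} (∣p∣≡k , bounds) =
  subst (∑ ℓ ≤_) (trans (sym (∣p∣≡∑∣p∩colourClass∣ col p)) ∣p∣≡k) (∑-mono (proj₁ ∘ bounds))

module _ {N n m} {f : HNode n m → HNode n m → ℕ} {pick : Fin n → Fin m → Fin N} where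

  ∈-outputS⁻ : ∀ {v} → v ∈ outputS f pick →
               ∃ λ i → ∃ λ j → 0 < f (dn i) (cn j) × pick i j ≡ v
  ∈-outputS⁻ =
    ∈-tabulate⁻ (λ v → any? λ i → any? λ j → (0 <? f (dn i) (cn j)) ×-dec (pick i j ≟ v))

  ∈-outputS⁺ : ∀ {i j} → 0 < f (dn i) (cn j) → pick i j ∈ outputS f pick
  ∈-outputS⁺ {i} {j} pos =
    ∈-tabulate⁺ (λ v → any? λ i → any? λ j → (0 <? f (dn i) (cn j)) ×-dec (pick i j ≟ v))
                (i , j , pos , refl)

module _ {N n m} {col : Fin N → Fin m} {D : Fin n → Subset N} (disjoint : PairwiseDisjoint D)
         {f : HNode n m → HNode n m → ℕ} {pick : Fin n → Fin m → Fin N}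
         (valid : ValidPick col D f pick) where

  private
    S : Subset N
    S = outputS f pick

    V : Fin m → Subset N
    V = colourClass col

  ∈S∩Vⱼ∩Dᵢ⁻ : ∀ {i j v} → v ∈ (S ∩ V j) ∩ D i → 0 < f (dn i) (cn j) × pick i j ≡ v
  ∈S∩Vⱼ∩Dᵢ⁻ v∈
    with v∈S∩Vⱼ , v∈Dᵢ ← x∈p∩q⁻ (S ∩ V _) (D _) v∈
    with v∈S , v∈Vⱼ ← x∈p∩q⁻ S (V _) v∈S∩Vⱼ
    with i′ , j′ , pos , refl ← ∈-outputS⁻ {f = f} {pick} v∈S
    with pick∈Dᵢ′ , col≡j′ ← valid i′ j′ pos
    with refl ← pairwiseDisjoint⇒≡ disjoint pick∈Dᵢ′ v∈Dᵢ
    with refl ← trans (sym col≡j′) (∈-colourClass⁻ v∈Vⱼ)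
    = pos , refl

  pick∈S∩Vⱼ∩Dᵢ : ∀ {i j} → 0 < f (dn i) (cn j) → pick i j ∈ (S ∩ V j) ∩ D i
  pick∈S∩Vⱼ∩Dᵢ {i} {j} pos with pick∈Dᵢ , col≡j ← valid i j pos =
    x∈p∩q⁺ (x∈p∩q⁺ (∈-outputS⁺ {f = f} {pick} pos , ∈-colourClass⁺ col≡j) , pick∈Dᵢ)

  ∣S∩Vⱼ∩Dᵢ∣≡f : ∀ {i j} → f (dn i) (cn j) ≤ 1 → ∣ (S ∩ V j) ∩ D i ∣ ≡ f (dn i) (cn j)
  ∣S∩Vⱼ∩Dᵢ∣≡f {i} {j} f≤1 with f (dn i) (cn j) in f≡
  ... | 0           = Empty⇒∣p∣≡0 λ (_ , v∈) → <-irrefl (sym f≡) (proj₁ (∈S∩Vⱼ∩Dᵢ⁻ v∈))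
  ... | 1           = ∣p∣≡1 (pick∈S∩Vⱼ∩Dᵢ (≤-reflexive (sym f≡))) (sym ∘ proj₂ ∘ ∈S∩Vⱼ∩Dᵢ⁻)
  ... | suc (suc _) with s≤s () ← f≤1

  ∣S∩Vⱼ∣≡∑f : ∀ {j} → (∀ i → f (dn i) (cn j) ≤ 1) → ∣ S ∩ V j ∣ ≡ ∑ (λ i → f (dn i) (cn j))
  ∣S∩Vⱼ∣≡∑f {j} f≤1 = trans (∣p∣≡∑∣p∩qᵢ∣ disjoint cover) (∑-cong (λ i → ∣S∩Vⱼ∩Dᵢ∣≡f (f≤1 i)))
    where
    cover : ∀ {v} → v ∈ S ∩ V j → ∃ λ i → v ∈ D i
    cover v∈ with i , j′ , pos , refl ← ∈-outputS⁻ {f = f} {pick} (proj₁ (x∈p∩q⁻ S (V j) v∈)) =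
      i , proj₁ (valid i j′ pos)

module _ {n m} (h : HNode n m → ℕ) where

  sumH-at-s : h z ≡ 0 → h t ≡ 0 → (∀ i → h (dn i) ≡ 0) → (∀ j → h (cn j) ≡ 0) →
              sumH h ≡ h s
  sumH-at-s hz ht hd hc rewrite hz | ht | ∑-zero hd | ∑-zero hc =
    trans (+-identityʳ _) (trans (+-identityʳ _) (trans (+-identityʳ _) (+-identityʳ _)))

  sumH-at-zt : h s ≡ 0 → (∀ i → h (dn i) ≡ 0) → (∀ j → h (cn j) ≡ 0) →
               sumH h ≡ h z + h t
  sumH-at-zt hs hd hc rewrite hs | ∑-zero hd | ∑-zero hc = trans (+-identityʳ _) (+-identityʳ _)

  sumH-at-dn : h s ≡ 0 → h z ≡ 0 → h t ≡ 0 → (∀ j → h (cn j) ≡ 0) →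
               sumH h ≡ ∑ (λ i → h (dn i))
  sumH-at-dn hs hz ht hc rewrite hs | hz | ht | ∑-zero hc = +-identityʳ _

  sumH-at-cn : h s ≡ 0 → h z ≡ 0 → h t ≡ 0 → (∀ i → h (dn i) ≡ 0) →
               sumH h ≡ ∑ (λ j → h (cn j))
  sumH-at-cn hs hz ht hd rewrite hs | hz | ht | ∑-zero hd = refl

record LayeredConservation {n m} (f : HNode n m → HNode n m → ℕ) : Set where
  field
    at-dn : ∀ i → f s (dn i) ≡ ∑ (λ j → f (dn i) (cn j))
    at-cn : ∀ j → ∑ (λ i → f (dn i) (cn j)) ≡ f (cn j) z + f (cn j) t
    at-z  : ∑ (λ j → f (cn j) z) ≡ f z t

module FlowNetwork {N n m} (col : Fin N → Fin m) (D : Fin n → Subset N) (ℓ u : Fin m → ℕ) (k : ℕ)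
  where

  private
    𝓗 : Network
    𝓗 = H col D ℓ u k

    cap : HNode n m → HNode n m → ℕ
    cap = capH col D ℓ u k

  cap-dn-cn≤1 : ∀ i j → cap (dn i) (cn j) ≤ 1
  cap-dn-cn≤1 i j with ⌊ any? (λ v → (v ∈? D i) ×-dec (col v ≟ j)) ⌋
  ... | true  = ≤-refl
  ... | false = z≤n

  cap-dn-cn≡1 : ∀ {i j} → HasColour col D i j → cap (dn i) (cn j) ≡ 1
  cap-dn-cn≡1 hasColour =
    cong (λ b → if b then 1 else 0) (Equivalence.to T-≡ (fromWitness hasColour))

  module Capacitated {f : HNode n m → HNode n m → ℕ} (f≤cap : ∀ x y → f x y ≤ cap x y) where

    off-edge : ∀ x y → cap x y ≡ 0 → f x y ≡ 0
    off-edge x y cap≡0 = n≤0⇒n≡0 (subst (f x y ≤_) cap≡0 (f≤cap x y))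

    inflow outflow : HNode n m → ℕ
    inflow  x = sumH (λ y → f y x)
    outflow x = sumH (f x)

    outflow-s : outflow s ≡ ∑ (λ i → f s (dn i))
    outflow-s = sumH-at-dn (f s) (off-edge s s refl) (off-edge s z refl) (off-edge s t refl)
                                 (λ j → off-edge s (cn j) refl)

    inflow-s : inflow s ≡ 0
    inflow-s = trans (sumH-at-s (λ y → f y s) (off-edge z s refl) (off-edge t s refl)
                                (λ i → off-edge (dn i) s refl) (λ j → off-edge (cn j) s refl))
                     (off-edge s s refl)

    inflow-dn : ∀ i → inflow (dn i) ≡ f s (dn i)
    inflow-dn i = sumH-at-s (λ y → f y (dn i)) (off-edge z (dn i) refl) (off-edge t (dn i) refl)
                            (λ i′ → off-edge (dn i′) (dn i) refl)
                            (λ j → off-edge (cn j) (dn i) refl)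

    outflow-dn : ∀ i → outflow (dn i) ≡ ∑ (λ j → f (dn i) (cn j))
    outflow-dn i = sumH-at-cn (f (dn i)) (off-edge (dn i) s refl) (off-edge (dn i) z refl)
                              (off-edge (dn i) t refl) (λ i′ → off-edge (dn i) (dn i′) refl)

    inflow-cn : ∀ j → inflow (cn j) ≡ ∑ (λ i → f (dn i) (cn j))
    inflow-cn j = sumH-at-dn (λ y → f y (cn j)) (off-edge s (cn j) refl) (off-edge z (cn j) refl)
                             (off-edge t (cn j) refl) (λ j′ → off-edge (cn j′) (cn j) refl)

    outflow-cn : ∀ j → outflow (cn j) ≡ f (cn j) z + f (cn j) t
    outflow-cn j = sumH-at-zt (f (cn j)) (off-edge (cn j) s refl)
                              (λ i → off-edge (cn j) (dn i) refl)
                              (λ j′ → off-edge (cn j) (cn j′) refl)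

    inflow-z : inflow z ≡ ∑ (λ j → f (cn j) z)
    inflow-z = sumH-at-cn (λ y → f y z) (off-edge s z refl) (off-edge z z refl)
                          (off-edge t z refl) (λ i → off-edge (dn i) z refl)

    outflow-z : outflow z ≡ f z t
    outflow-z = trans (sumH-at-zt (f z) (off-edge z s refl) (λ i → off-edge z (dn i) refl)
                                  (λ j → off-edge z (cn j) refl))
                      (cong (_+ f z t) (off-edge z z refl))

    value≡∑f-s-dn : value 𝓗 f ≡ ∑ (λ i → f s (dn i))
    value≡∑f-s-dn = cong₂ _∸_ outflow-s inflow-s

    Conserved : Set
    Conserved = ∀ x → x ≢ s → x ≢ t → inflow x ≡ outflow x

    conserved⇒layered : Conserved → LayeredConservation f
    conserved⇒layered conserved = record
      { at-dn = λ i → trans (sym (inflow-dn i))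
                            (trans (conserved (dn i) (λ ()) (λ ())) (outflow-dn i))
      ; at-cn = λ j → trans (sym (inflow-cn j))
                            (trans (conserved (cn j) (λ ()) (λ ())) (outflow-cn j))
      ; at-z  = trans (sym inflow-z) (trans (conserved z (λ ()) (λ ())) outflow-z)
      }

    layered⇒conserved : LayeredConservation f → Conserved
    layered⇒conserved layered = conserved
      where
      open LayeredConservation layered
      conserved : Conserved
      conserved s      s≢s _   = ⊥-elim (s≢s refl)
      conserved t      _   t≢t = ⊥-elim (t≢t refl)
      conserved z      _   _   = trans inflow-z (trans at-z (sym outflow-z))
      conserved (dn i) _   _   = trans (inflow-dn i) (trans (at-dn i) (sym (outflow-dn i)))
      conserved (cn j) _   _   = trans (inflow-cn j) (trans (at-cn j) (sym (outflow-cn j)))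

  module _ {f : HNode n m → HNode n m → ℕ} where

    isFlow⇒layered : IsFlow 𝓗 f → LayeredConservation f
    isFlow⇒layered (f≤cap , conserved) = Capacitated.conserved⇒layered f≤cap conserved

    layered⇒isFlow : (∀ x y → f x y ≤ cap x y) → LayeredConservation f → IsFlow 𝓗 f
    layered⇒isFlow f≤cap layered = f≤cap , Capacitated.layered⇒conserved f≤cap layered

    value≡inflow-t : IsFlow 𝓗 f → value 𝓗 f ≡ f z t + ∑ (λ j → f (cn j) t)
    value≡inflow-t flow@(f≤cap , _) = begin
      value 𝓗 f                                     ≡⟨ Capacitated.value≡∑f-s-dn f≤cap ⟩
      ∑ (λ i → f s (dn i))                          ≡⟨ ∑-cong at-dn ⟩
      ∑ (λ i → ∑ (λ j → f (dn i) (cn j)))           ≡⟨ ∑-comm (λ i j → f (dn i) (cn j)) ⟩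
      ∑ (λ j → ∑ (λ i → f (dn i) (cn j)))           ≡⟨ ∑-cong at-cn ⟩
      ∑ (λ j → f (cn j) z + f (cn j) t)             ≡⟨ ∑-distrib-+ (λ j → f (cn j) z) _ ⟩
      ∑ (λ j → f (cn j) z) + ∑ (λ j → f (cn j) t)   ≡⟨ cong (_+ ∑ (λ j → f (cn j) t)) at-z ⟩
      f z t + ∑ (λ j → f (cn j) t)                  ∎
      where
      open ≡-Reasoning
      open LayeredConservation (isFlow⇒layered flow)

    value≤k : ∑ ℓ ≤ k → IsFlow 𝓗 f → value 𝓗 f ≤ k
    value≤k ∑ℓ≤k flow@(f≤cap , _) = begin
      value 𝓗 f                      ≡⟨ value≡inflow-t flow ⟩
      f z t + ∑ (λ j → f (cn j) t)   ≤⟨ +-mono-≤ (f≤cap z t) (∑-mono (λ j → f≤cap (cn j) t)) ⟩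
      (k ∸ ∑ ℓ) + ∑ ℓ                ≡⟨ m∸n+n≡m ∑ℓ≤k ⟩
      k                              ∎
      where open ≤-Reasoning

    k≤value⇒cⱼt-saturated : ∑ ℓ ≤ k → IsFlow 𝓗 f → k ≤ value 𝓗 f → ∀ j → ℓ j ≤ f (cn j) t
    k≤value⇒cⱼt-saturated ∑ℓ≤k flow@(f≤cap , _) k≤value =
      ∑-mono-tight (λ j → f≤cap (cn j) t) (+-cancelˡ-≤ (k ∸ ∑ ℓ) _ _ (begin
        (k ∸ ∑ ℓ) + ∑ ℓ                    ≡⟨ m∸n+n≡m ∑ℓ≤k ⟩
        k                                  ≤⟨ k≤value ⟩
        value 𝓗 f                          ≡⟨ value≡inflow-t flow ⟩
        f z t + ∑ (λ j → f (cn j) t)       ≤⟨ +-monoˡ-≤ _ (f≤cap z t) ⟩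
        (k ∸ ∑ ℓ) + ∑ (λ j → f (cn j) t)   ∎))
      where open ≤-Reasoning

  inducedFlow : Subset N → HNode n m → HNode n m → ℕ
  inducedFlow O s      (dn i) = ∣ O ∩ D i ∣
  inducedFlow O (dn i) (cn j) = ∣ (O ∩ D i) ∩ colourClass col j ∣
  inducedFlow O (cn j) z      = ∣ O ∩ colourClass col j ∣ ∸ ℓ j
  inducedFlow O (cn j) t      = ℓ j
  inducedFlow O z      t      = k ∸ ∑ ℓ
  inducedFlow O _      _      = 0

  module InducedFlow (disjoint : PairwiseDisjoint D) {O : Subset N} (O-fair : Fair col ℓ u k O)
                     (∣D∩O∣≤1 : ∀ i → ∣ D i ∩ O ∣ ≤ 1) (O⊆⋃D : O ⊆ ⋃Fam D) where

    private
      V : Fin m → Subset N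
      V = colourClass col

      g : HNode n m → HNode n m → ℕ
      g = inducedFlow O

      ∣O∣≡k : ∣ O ∣ ≡ k
      ∣O∣≡k = proj₁ O-fair

      ℓ≤∣O∩V∣ : ∀ j → ℓ j ≤ ∣ O ∩ V j ∣
      ℓ≤∣O∩V∣ j = proj₁ (proj₂ O-fair j)

      ∣O∩V∣≤u : ∀ j → ∣ O ∩ V j ∣ ≤ u j
      ∣O∩V∣≤u j = proj₂ (proj₂ O-fair j)

    ∣O∩D∣≤1 : ∀ i → ∣ O ∩ D i ∣ ≤ 1
    ∣O∩D∣≤1 i = subst (_≤ 1) (cong ∣_∣ (∩-comm (D i) O)) (∣D∩O∣≤1 i)

    ∣p∣≡∑∣p∩D∣ : ∀ {p} → p ⊆ O → ∣ p ∣ ≡ ∑ (λ i → ∣ p ∩ D i ∣)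
    ∣p∣≡∑∣p∩D∣ p⊆O = ∣p∣≡∑∣p∩qᵢ∣ disjoint (x∈⋃map⁻ D (allFin n) ∘ O⊆⋃D ∘ p⊆O)

    g-dn-cn≤cap : ∀ i j → g (dn i) (cn j) ≤ cap (dn i) (cn j)
    g-dn-cn≤cap i j with nonempty? ((O ∩ D i) ∩ V j)
    ... | no empty = subst (_≤ cap (dn i) (cn j)) (sym (Empty⇒∣p∣≡0 empty)) z≤n
    ... | yes (v , v∈O∩Dᵢ∩Vⱼ) with v∈O∩Dᵢ , v∈Vⱼ ← x∈p∩q⁻ (O ∩ D i) (V j) v∈O∩Dᵢ∩Vⱼ =
      subst (g (dn i) (cn j) ≤_) (sym (cap-dn-cn≡1 hasColour))
            (≤-trans (∣p∩q∣≤∣p∣ (O ∩ D i) (V j)) (∣O∩D∣≤1 i))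
      where
      hasColour : HasColour col D i j
      hasColour = v , proj₂ (x∈p∩q⁻ O (D i) v∈O∩Dᵢ) , ∈-colourClass⁻ v∈Vⱼ

    g≤cap : ∀ x y → g x y ≤ cap x y
    g≤cap s      (dn i) = ∣O∩D∣≤1 i
    g≤cap (dn i) (cn j) = g-dn-cn≤cap i j
    g≤cap (cn j) z      = ∸-monoˡ-≤ (ℓ j) (∣O∩V∣≤u j)
    g≤cap (cn j) t      = ≤-refl
    g≤cap z      t      = ≤-refl
    g≤cap s      s      = z≤n
    g≤cap s      z      = z≤n
    g≤cap s      t      = z≤n
    g≤cap s      (cn _) = z≤n
    g≤cap z      s      = z≤n
    g≤cap z      z      = z≤n
    g≤cap z      (dn _) = z≤n
    g≤cap z      (cn _) = z≤n
    g≤cap t      _      = z≤n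
    g≤cap (dn _) s      = z≤n
    g≤cap (dn _) z      = z≤n
    g≤cap (dn _) t      = z≤n
    g≤cap (dn _) (dn _) = z≤n
    g≤cap (cn _) s      = z≤n
    g≤cap (cn _) (dn _) = z≤n
    g≤cap (cn _) (cn _) = z≤n

    g-layered : LayeredConservation g
    g-layered = record
      { at-dn = λ i → ∣p∣≡∑∣p∩colourClass∣ col (O ∩ D i)
      ; at-cn = λ j → begin
          ∑ (λ i → ∣ (O ∩ D i) ∩ V j ∣)  ≡⟨ ∑-cong (λ i → cong ∣_∣ (xy∙z≈xz∙y O (D i) (V j))) ⟩
          ∑ (λ i → ∣ (O ∩ V j) ∩ D i ∣)  ≡⟨ ∣p∣≡∑∣p∩D∣ (proj₁ ∘ x∈p∩q⁻ O (V j)) ⟨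
          ∣ O ∩ V j ∣                     ≡⟨ m∸n+n≡m (ℓ≤∣O∩V∣ j) ⟨
          (∣ O ∩ V j ∣ ∸ ℓ j) + ℓ j       ∎
      ; at-z = begin
          ∑ (λ j → ∣ O ∩ V j ∣ ∸ ℓ j)     ≡⟨ ∑-∸ ℓ≤∣O∩V∣ ⟩
          ∑ (λ j → ∣ O ∩ V j ∣) ∸ ∑ ℓ     ≡⟨ cong (_∸ ∑ ℓ) (∣p∣≡∑∣p∩colourClass∣ col O) ⟨
          ∣ O ∣ ∸ ∑ ℓ                     ≡⟨ cong (_∸ ∑ ℓ) ∣O∣≡k ⟩
          k ∸ ∑ ℓ                         ∎
      }
      where
      open ≡-Reasoning
      open CommutativeSemigroupProperties
        (CommutativeMonoid.commutativeSemigroup (∩-commutativeMonoid N)) using (xy∙z≈xz∙y)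

    inducedFlow-isFlow : IsFlow 𝓗 (inducedFlow O)
    inducedFlow-isFlow = layered⇒isFlow g≤cap g-layered

    inducedFlow-value : value 𝓗 (inducedFlow O) ≡ k
    inducedFlow-value = begin
      value 𝓗 g               ≡⟨ Capacitated.value≡∑f-s-dn g≤cap ⟩
      ∑ (λ i → ∣ O ∩ D i ∣)   ≡⟨ ∣p∣≡∑∣p∩D∣ id ⟨
      ∣ O ∣                   ≡⟨ ∣O∣≡k ⟩
      k                       ∎
      where open ≡-Reasoning

  outputS-fair : (∀ j → ℓ j ≤ u j) → PairwiseDisjoint D →
                 ∀ {f pick} → IsFlow 𝓗 f → ValidPick col D f pick → value 𝓗 f ≡ k →
                 (∀ j → ℓ j ≤ f (cn j) t) → Fair col ℓ u k (outputS f pick)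
  outputS-fair ℓ≤u disjoint {f} {pick} flow@(f≤cap , _) valid value≡k ℓ≤f-cn-t =
    ∣S∣≡k , λ j → ℓ≤∣S∩Vⱼ∣ j , ∣S∩Vⱼ∣≤u j
    where
    open LayeredConservation (isFlow⇒layered flow)

    S : Subset N
    S = outputS f pick

    V : Fin m → Subset N
    V = colourClass col

    ∣S∩Vⱼ∣≡∑ᵢf : ∀ j → ∣ S ∩ V j ∣ ≡ ∑ (λ i → f (dn i) (cn j))
    ∣S∩Vⱼ∣≡∑ᵢf j = ∣S∩Vⱼ∣≡∑f disjoint {f = f} {pick} valid
                              (λ i → ≤-trans (f≤cap (dn i) (cn j)) (cap-dn-cn≤1 i j))

    ∣S∩Vⱼ∣≡f-cn : ∀ j → ∣ S ∩ V j ∣ ≡ f (cn j) z + f (cn j) t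
    ∣S∩Vⱼ∣≡f-cn j = trans (∣S∩Vⱼ∣≡∑ᵢf j) (at-cn j)

    ℓ≤∣S∩Vⱼ∣ : ∀ j → ℓ j ≤ ∣ S ∩ V j ∣
    ℓ≤∣S∩Vⱼ∣ j = subst (ℓ j ≤_) (sym (∣S∩Vⱼ∣≡f-cn j)) (≤-trans (ℓ≤f-cn-t j) (m≤n+m _ _))

    ∣S∩Vⱼ∣≤u : ∀ j → ∣ S ∩ V j ∣ ≤ u j
    ∣S∩Vⱼ∣≤u j = subst (_≤ u j) (sym (∣S∩Vⱼ∣≡f-cn j))
      (≤-trans (+-mono-≤ (f≤cap (cn j) z) (f≤cap (cn j) t)) (≤-reflexive (m∸n+n≡m (ℓ≤u j))))

    ∣S∣≡k : ∣ S ∣ ≡ k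
    ∣S∣≡k = begin
      ∣ S ∣                                  ≡⟨ ∣p∣≡∑∣p∩colourClass∣ col S ⟩
      ∑ (λ j → ∣ S ∩ V j ∣)                  ≡⟨ ∑-cong ∣S∩Vⱼ∣≡∑ᵢf ⟩
      ∑ (λ j → ∑ (λ i → f (dn i) (cn j)))    ≡⟨ ∑-comm (λ j i → f (dn i) (cn j)) ⟩
      ∑ (λ i → ∑ (λ j → f (dn i) (cn j)))    ≡⟨ ∑-cong at-dn ⟨
      ∑ (λ i → f s (dn i))                   ≡⟨ Capacitated.value≡∑f-s-dn f≤cap ⟨
      value 𝓗 f                              ≡⟨ value≡k ⟩
      k                                      ∎
      where open ≡-Reasoning

proposition3p6 : ∀ {N m n : ℕ} (col : Fin N → Fin m) (k : ℕ) (ℓ u : Fin m → ℕ) →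
    (∀ j → ℓ j ≤ u j) →
    (D : Fin n → Subset N) → PairwiseDisjoint D →
    Σ (Subset N) (λ O → Fair col ℓ u k O × (∀ i → ∣ D i ∩ O ∣ ≤ 1) × O ⊆ ⋃Fam D) →
    (f : HNode n m → HNode n m → ℕ) → IsMaxFlow (H col D ℓ u k) f →
    (pick : Fin n → Fin m → Fin N) → ValidPick col D f pick →
    Fair col ℓ u k (outputS f pick)
proposition3p6 col k ℓ u ℓ≤u D disjoint (O , O-fair , ∣D∩O∣≤1 , O⊆⋃D)
               f (flow , maximum) pick valid =
  outputS-fair ℓ≤u disjoint flow valid value≡k (k≤value⇒cⱼt-saturated ∑ℓ≤k flow k≤value)
  where
  open FlowNetwork col D ℓ u k
  open InducedFlow disjoint O-fair ∣D∩O∣≤1 O⊆⋃D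

  ∑ℓ≤k : ∑ ℓ ≤ k
  ∑ℓ≤k = Fair⇒∑ℓ≤k {col = col} {p = O} O-fair

  k≤value : k ≤ value (H col D ℓ u k) f
  k≤value = subst (_≤ value (H col D ℓ u k) f) inducedFlow-value
                  (maximum (inducedFlow O) inducedFlow-isFlow)

  value≡k : value (H col D ℓ u k) f ≡ k
  value≡k = ≤-antisym (value≤k ∑ℓ≤k flow) k≤value
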